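{- There is a gradient vector field on the matching complex $M_7$ with respect to which there are exactly $22$ critical $2$-simplices, exactly two critical $1$-simplices, and exactly one critical $0$-simplex.
   Context: The matching complex $M_7$ is the simplicial complex whose simplices are the matchings of the complete graph $K_7$ (sets of pairwise vertex-disjoint edges), including the empty matching; it has dimension $2$. A discrete vector field on a complex is a set of pairs $(\alpha,\beta)$ of simplices (the empty simplex allowed) with $\alpha\subsetneq\beta$, $\dim\beta=\dim\alpha+1$, each simplex in at most one pair. A path is $\alpha_0,\beta_0,\alpha_1,\dots,\alpha_k,\beta_k,\alpha_{k+1}$ with $(\alpha_i,\beta_i)$ in the field and $\beta_i\supsetneq\alpha_{i+1}\ne\alpha_i$; a gradient vector field is a discrete vector field with no path having $k\ge0$ and $\alpha_{k+1}=\alpha_0$. A nonempty simplex is critical if it appears in no pair, or it is a $0$-simplex paired with $\emptyset$. -}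

module Defs where

open import Data.Nat using (ℕ; suc)
open import Data.Fin using (Fin; _<_)
open import Data.Product using (_×_; _,_; proj₁; proj₂; Σ; ∃-syntax)
open import Data.Sum using (_⊎_)
open import Data.List using (List; []; _∷_; length)
open import Data.List.Membership.Propositional using (_∈_)
open import Data.List.Relation.Unary.All using (All)
open import Data.List.Relation.Unary.Any using (Any)
open import Data.List.Relation.Unary.Unique.Propositional using (Unique)
open import Data.List.Relation.Unary.AllPairs using (AllPairs)
open import Data.List.Relation.Binary.Subset.Propositional using (_⊆_)
open import Relation.Binary.Construct.Closure.Transitive using (TransClosure)
open import Relation.Binary.PropositionalEquality using (_≡_; _≢_)
open import Relation.Nullary using (¬_)

-- An edge of K_n is an ordered pair (i , j) of vertices with i < j
-- (canonical orientation, so each edge of K_n has exactly one representation).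
Edge : ℕ → Set
Edge n = Fin n × Fin n

IsEdge : ∀ {n} → Edge n → Set
IsEdge (i , j) = i < j

VDisjoint : ∀ {n} → Edge n → Edge n → Set
VDisjoint (i , j) (k , l) = (i ≢ k) × (i ≢ l) × (j ≢ k) × (j ≢ l)

-- A finite set of edges, represented by a list (set semantics: membership).
Face : ℕ → Set
Face n = List (Edge n)

-- A simplex of the matching complex M_n: a duplicate-free list of edges of K_n
-- that are pairwise vertex-disjoint (the empty list is the empty simplex).
IsMatching : ∀ {n} → Face n → Set
IsMatching σ = All IsEdge σ × Unique σ × AllPairs VDisjoint σ

_≈ₛ_ : ∀ {n} → Face n → Face n → Set
σ ≈ₛ τ = (σ ⊆ τ) × (τ ⊆ σ)

-- Dimension: a simplex with d+1 edges has dimension d; we talk in terms of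
-- number of edges (size) to avoid the dimension -1 of the empty simplex.
-- A d-simplex is a matching of size d+1.

VectorField : ℕ → Set
VectorField n = List (Face n × Face n)

occurring : ∀ {n} → VectorField n → List (Face n)
occurring [] = []
occurring ((α , β) ∷ V) = α ∷ β ∷ occurring V

IsDiscreteVectorField : ∀ {n} → VectorField n → Set
IsDiscreteVectorField V =
  All (λ p → IsMatching (proj₁ p) × IsMatching (proj₂ p)
             × (proj₁ p ⊆ proj₂ p) × (length (proj₂ p) ≡ suc (length (proj₁ p)))) V
  × AllPairs (λ σ τ → ¬ (σ ≈ₛ τ)) (occurring V)

Step : ∀ {n} → VectorField n → (Face n × Face n) → (Face n × Face n) → Set
Step V (α , β) (α' , β') =
  ((α , β) ∈ V) × ((α' , β') ∈ V) × (α' ⊆ β) × ¬ (α' ≈ₛ β) × ¬ (α' ≈ₛ α)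

-- Gradient: no closed V-path α_0, β_0, ..., β_k, α_{k+1} = α_0 with k ≥ 0.
-- A closed path through pairs p_0, ..., p_k is exactly a nonempty chain of
-- steps p_0 → p_1 → ... → p_k → p_0.
IsGradientVectorField : ∀ {n} → VectorField n → Set
IsGradientVectorField V =
  IsDiscreteVectorField V × (∀ p → ¬ TransClosure (Step V) p p)

IsCritical : ∀ {n} → VectorField n → Face n → Set
IsCritical V σ =
  (¬ Any (λ τ → σ ≈ₛ τ) (occurring V))
  ⊎ ((length σ ≡ 1) × Any (λ p → (proj₁ p ≡ []) × (proj₂ p ≈ₛ σ)) V)

ExactlyCritical : ∀ {n} → VectorField n → (d k : ℕ) → Set
ExactlyCritical {n} V d k =
  ∃[ cs ] ( (length cs ≡ k)
          × All (λ σ → IsMatching σ × (length σ ≡ suc d) × IsCritical V σ) cs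
          × AllPairs (λ σ τ → ¬ (σ ≈ₛ τ)) cs
          × (∀ (σ : Face n) → IsMatching σ → length σ ≡ suc d → IsCritical V σ
               → Any (λ τ → σ ≈ₛ τ) cs) )

module Submission where

-- Its pairs are listed so that whenever a V-path
-- passes from a pair p to a pair q, q comes strictly later in the list; the
-- position in the list therefore increases along V-paths and no V-path closes
-- up. Everything else concerns finitely many simplices of M₇ and is decided by
-- evaluation: the discrete-field axioms pair by pair, and the critical simplices
-- of each dimension by running through all matchings of that size.

open import Defs
open import Data.Bool using (if_then_else_)
open import Data.Fin using (#_)
open import Data.Fin.Properties as Fin using ()
open import Data.List using (List; []; _∷_; length; map; concatMap; filter; cartesianProduct; allFin)
open import Data.List.Membership.Propositional using (_∈_)
open import Data.List.Membership.Propositional.Properties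
  using (∈-filter⁺; ∈-map⁺; ∈-concatMap⁺; ∈-cartesianProduct⁺; ∈-allFin)
open import Data.List.Properties as List using ()
open import Data.List.Relation.Binary.Subset.Propositional using (_⊆_)
open import Data.List.Relation.Unary.All as All using (All; []; _∷_; all?)
open import Data.List.Relation.Unary.AllPairs using (AllPairs; []; _∷_; allPairs?)
open import Data.List.Relation.Unary.Any as Any using (Any; here; any?)
open import Data.Nat using (ℕ; suc; _<_; _≟_; _<?_)
open import Data.Nat.Properties using (<-trans; <-irrefl)
open import Data.Product using (_×_; _,_; proj₁; proj₂; ∃-syntax)
open import Data.Product.Properties using (≡-dec)
open import Relation.Binary using (Rel; DecidableEquality)
open import Relation.Binary.Construct.Closure.Transitive using (TransClosure; [_]; _∷_)
open import Relation.Binary.PropositionalEquality using (_≡_; refl; subst)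
open import Relation.Nullary using (¬_; Dec; does; ¬?)
open import Relation.Nullary.Decidable using (from-yes; _×-dec_; _⊎-dec_; _→-dec_)
open import Relation.Unary using (Decidable)

position : {A : Set} → DecidableEquality A → A → List A → ℕ
position _≟ₐ_ x []       = 0
position _≟ₐ_ x (y ∷ ys) = if does (x ≟ₐ y) then 0 else suc (position _≟ₐ_ x ys)

module _ {A : Set} {ℓ} {R : Rel A ℓ} (rank : A → ℕ)
         (increasing : ∀ {x y} → R x y → rank x < rank y) where

  rank-increasing⁺ : ∀ {x y} → TransClosure R x y → rank x < rank y
  rank-increasing⁺ [ xRy ]     = increasing xRy
  rank-increasing⁺ (xRy ∷ y⁺z) = <-trans (increasing xRy) (rank-increasing⁺ y⁺z)

  ranked⇒acyclic : ∀ x → ¬ TransClosure R x x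
  ranked⇒acyclic x x⁺x = <-irrefl refl (rank-increasing⁺ x⁺x)

module _ {n : ℕ} where

  _≟ᵉ_ : DecidableEquality (Edge n)
  _≟ᵉ_ = ≡-dec Fin._≟_ Fin._≟_

  open import Data.List.Relation.Binary.Subset.DecPropositional _≟ᵉ_ using (_⊆?_)
  open import Data.List.Relation.Unary.Unique.DecPropositional _≟ᵉ_ using (unique?)

  _≟ᶠ_ : DecidableEquality (Face n)
  _≟ᶠ_ = List.≡-dec _≟ᵉ_

  _≟ᵖ_ : DecidableEquality (Face n × Face n)
  _≟ᵖ_ = ≡-dec _≟ᶠ_ _≟ᶠ_

  _≈ₛ?_ : (σ τ : Face n) → Dec (σ ≈ₛ τ)
  σ ≈ₛ? τ = (σ ⊆? τ) ×-dec (τ ⊆? σ)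

  isEdge? : Decidable (IsEdge {n})
  isEdge? (i , j) = i Fin.<? j

  vDisjoint? : (e f : Edge n) → Dec (VDisjoint e f)
  vDisjoint? (i , j) (k , l) =
    ¬? (i Fin.≟ k) ×-dec ¬? (i Fin.≟ l) ×-dec ¬? (j Fin.≟ k) ×-dec ¬? (j Fin.≟ l)

  isMatching? : Decidable (IsMatching {n})
  isMatching? σ = all? isEdge? σ ×-dec unique? σ ×-dec allPairs? vDisjoint? σ

  pairwiseDistinct? : Decidable (AllPairs (λ (σ τ : Face n) → ¬ (σ ≈ₛ τ)))
  pairwiseDistinct? = allPairs? (λ σ τ → ¬? (σ ≈ₛ? τ))

  isDiscreteVectorField? : Decidable (IsDiscreteVectorField {n})
  isDiscreteVectorField? V = all? isFacePair? V ×-dec pairwiseDistinct? (occurring V)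
    where
    isFacePair? : (p : Face n × Face n) → Dec (IsMatching (proj₁ p) × IsMatching (proj₂ p)
                    × (proj₁ p ⊆ proj₂ p) × (length (proj₂ p) ≡ suc (length (proj₁ p))))
    isFacePair? (α , β) =
      isMatching? α ×-dec isMatching? β ×-dec (α ⊆? β) ×-dec (length β ≟ suc (length α))

  isCritical? : (V : VectorField n) → Decidable (IsCritical V)
  isCritical? V σ = ¬? (any? (σ ≈ₛ?_) (occurring V))
    ⊎-dec ((length σ ≟ 1) ×-dec any? (λ p → (proj₁ p ≟ᶠ []) ×-dec (proj₂ p ≈ₛ? σ)) V)

  edges : List (Edge n)
  edges = filter isEdge? (cartesianProduct (allFin n) (allFin n))

  ∈-edges : {e : Edge n} → IsEdge e → e ∈ edges
  ∈-edges {i , j} i<j = ∈-filter⁺ isEdge? (∈-cartesianProduct⁺ (∈-allFin i) (∈-allFin j)) i<j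

  extensions : Face n → List (Face n)
  extensions τ = map (_∷ τ) (filter (λ e → all? (vDisjoint? e) τ) edges)

  matchings : ℕ → List (Face n)
  matchings 0       = [] ∷ []
  matchings (suc k) = concatMap extensions (matchings k)

  ∈-extensions : {e : Edge n} {τ : Face n} → IsEdge e → All (VDisjoint e) τ → e ∷ τ ∈ extensions τ
  ∈-extensions {τ = τ} e-edge e-τ =
    ∈-map⁺ (_∷ τ) (∈-filter⁺ (λ f → all? (vDisjoint? f) τ) (∈-edges e-edge) e-τ)

  ∈-matchings : {σ : Face n} → All IsEdge σ → AllPairs VDisjoint σ → σ ∈ matchings (length σ)
  ∈-matchings []                 []                 = here refl
  ∈-matchings (e-edge ∷ τ-edges) (e-τ ∷ τ-disjoint) =
    ∈-concatMap⁺ extensions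
      (Any.map (λ { refl → ∈-extensions e-edge e-τ }) (∈-matchings τ-edges τ-disjoint))

  -- Step V p q unfolds to (p ∈ V) × (q ∈ V) × Follows p q.
  Follows : Rel (Face n × Face n) _
  Follows (α , β) (α′ , β′) = (α′ ⊆ β) × ¬ (α′ ≈ₛ β) × ¬ (α′ ≈ₛ α)

  follows? : (p q : Face n × Face n) → Dec (Follows p q)
  follows? (α , β) (α′ , β′) = (α′ ⊆? β) ×-dec ¬? (α′ ≈ₛ? β) ×-dec ¬? (α′ ≈ₛ? α)

  ForwardOrdered : VectorField n → Set
  ForwardOrdered V =
    All (λ p → All (λ q → Follows p q → position _≟ᵖ_ p V < position _≟ᵖ_ q V) V) V

  forwardOrdered? : Decidable ForwardOrdered
  forwardOrdered? V =
    all? (λ p → all? (λ q → follows? p q →-dec (position _≟ᵖ_ p V <? position _≟ᵖ_ q V)) V) V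

  forwardOrdered⇒gradient : (V : VectorField n) →
    IsDiscreteVectorField V → ForwardOrdered V → IsGradientVectorField V
  forwardOrdered⇒gradient V discrete forward =
    discrete , ranked⇒acyclic (λ p → position _≟ᵖ_ p V) step-forward
    where
    step-forward : ∀ {p q} → Step V p q → position _≟ᵖ_ p V < position _≟ᵖ_ q V
    step-forward {_ , _} {_ , _} (p∈V , q∈V , p↝q) = All.lookup (All.lookup forward p∈V) q∈V p↝q
  EnumeratesCritical : VectorField n → ℕ → List (Face n) → Set
  EnumeratesCritical V d cs =
    All (λ σ → IsMatching σ × (length σ ≡ suc d) × IsCritical V σ) cs
    × AllPairs (λ σ τ → ¬ (σ ≈ₛ τ)) cs
    × All (λ σ → IsCritical V σ → Any (σ ≈ₛ_) cs) (matchings (suc d))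

  enumeratesCritical? : (V : VectorField n) (d : ℕ) → Decidable (EnumeratesCritical V d)
  enumeratesCritical? V d cs =
    all? (λ σ → isMatching? σ ×-dec (length σ ≟ suc d) ×-dec isCritical? V σ) cs
    ×-dec pairwiseDistinct? cs
    ×-dec all? (λ σ → isCritical? V σ →-dec any? (σ ≈ₛ?_) cs) (matchings (suc d))

  enumeratesCritical⇒exactlyCritical : (V : VectorField n) (d : ℕ) (cs : List (Face n)) →
    EnumeratesCritical V d cs → ExactlyCritical V d (length cs)
  enumeratesCritical⇒exactlyCritical V d cs (valid , distinct , complete) =
    cs , refl , valid , distinct , covered
    where
    covered : ∀ σ → IsMatching σ → length σ ≡ suc d → IsCritical V σ → Any (σ ≈ₛ_) cs
    covered σ (σ-edges , _ , σ-disjoint) |σ|≡1+d =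
      All.lookup complete (subst (λ k → σ ∈ matchings k) |σ|≡1+d (∈-matchings σ-edges σ-disjoint))

V₇ : VectorField 7
V₇ =
  (((# 0 , # 2) ∷ (# 1 , # 4) ∷ []) , ((# 0 , # 2) ∷ (# 1 , # 4) ∷ (# 3 , # 6) ∷ [])) ∷
  (((# 0 , # 1) ∷ (# 2 , # 4) ∷ []) , ((# 0 , # 1) ∷ (# 2 , # 4) ∷ (# 3 , # 6) ∷ [])) ∷
  (((# 0 , # 4) ∷ (# 1 , # 2) ∷ []) , ((# 0 , # 4) ∷ (# 1 , # 2) ∷ (# 3 , # 6) ∷ [])) ∷
  (((# 1 , # 3) ∷ (# 5 , # 6) ∷ []) , ((# 0 , # 4) ∷ (# 1 , # 3) ∷ (# 5 , # 6) ∷ [])) ∷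
  (((# 1 , # 5) ∷ (# 3 , # 6) ∷ []) , ((# 0 , # 4) ∷ (# 1 , # 5) ∷ (# 3 , # 6) ∷ [])) ∷
  (((# 1 , # 2) ∷ (# 3 , # 5) ∷ []) , ((# 0 , # 6) ∷ (# 1 , # 2) ∷ (# 3 , # 5) ∷ [])) ∷
  (((# 0 , # 6) ∷ (# 3 , # 5) ∷ []) , ((# 0 , # 6) ∷ (# 2 , # 4) ∷ (# 3 , # 5) ∷ [])) ∷
  (((# 3 , # 5) ∷ (# 4 , # 6) ∷ []) , ((# 0 , # 1) ∷ (# 3 , # 5) ∷ (# 4 , # 6) ∷ [])) ∷
  (((# 2 , # 4) ∷ (# 5 , # 6) ∷ []) , ((# 0 , # 3) ∷ (# 2 , # 4) ∷ (# 5 , # 6) ∷ [])) ∷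
  (((# 0 , # 3) ∷ (# 5 , # 6) ∷ []) , ((# 0 , # 3) ∷ (# 1 , # 2) ∷ (# 5 , # 6) ∷ [])) ∷
  (((# 0 , # 1) ∷ (# 3 , # 5) ∷ []) , ((# 0 , # 1) ∷ (# 2 , # 6) ∷ (# 3 , # 5) ∷ [])) ∷
  (((# 1 , # 4) ∷ (# 3 , # 5) ∷ []) , ((# 1 , # 4) ∷ (# 2 , # 6) ∷ (# 3 , # 5) ∷ [])) ∷
  (((# 2 , # 6) ∷ (# 3 , # 5) ∷ []) , ((# 0 , # 4) ∷ (# 2 , # 6) ∷ (# 3 , # 5) ∷ [])) ∷
  (((# 0 , # 4) ∷ (# 2 , # 6) ∷ []) , ((# 0 , # 4) ∷ (# 1 , # 5) ∷ (# 2 , # 6) ∷ [])) ∷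
  (((# 0 , # 6) ∷ (# 2 , # 4) ∷ []) , ((# 0 , # 6) ∷ (# 1 , # 5) ∷ (# 2 , # 4) ∷ [])) ∷
  (((# 1 , # 5) ∷ (# 2 , # 4) ∷ []) , ((# 0 , # 3) ∷ (# 1 , # 5) ∷ (# 2 , # 4) ∷ [])) ∷
  (((# 0 , # 3) ∷ (# 1 , # 5) ∷ []) , ((# 0 , # 3) ∷ (# 1 , # 5) ∷ (# 2 , # 6) ∷ [])) ∷
  (((# 0 , # 2) ∷ (# 4 , # 6) ∷ []) , ((# 0 , # 2) ∷ (# 1 , # 5) ∷ (# 4 , # 6) ∷ [])) ∷
  (((# 0 , # 3) ∷ (# 1 , # 4) ∷ []) , ((# 0 , # 3) ∷ (# 1 , # 4) ∷ (# 2 , # 5) ∷ [])) ∷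
  (((# 1 , # 4) ∷ (# 2 , # 5) ∷ []) , ((# 0 , # 6) ∷ (# 1 , # 4) ∷ (# 2 , # 5) ∷ [])) ∷
  (((# 0 , # 4) ∷ (# 1 , # 3) ∷ []) , ((# 0 , # 4) ∷ (# 1 , # 3) ∷ (# 2 , # 5) ∷ [])) ∷
  (((# 1 , # 3) ∷ (# 2 , # 5) ∷ []) , ((# 0 , # 6) ∷ (# 1 , # 3) ∷ (# 2 , # 5) ∷ [])) ∷
  (((# 0 , # 3) ∷ (# 4 , # 6) ∷ []) , ((# 0 , # 3) ∷ (# 2 , # 5) ∷ (# 4 , # 6) ∷ [])) ∷
  (((# 2 , # 5) ∷ (# 4 , # 6) ∷ []) , ((# 0 , # 1) ∷ (# 2 , # 5) ∷ (# 4 , # 6) ∷ [])) ∷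
  (((# 0 , # 4) ∷ (# 3 , # 6) ∷ []) , ((# 0 , # 4) ∷ (# 2 , # 5) ∷ (# 3 , # 6) ∷ [])) ∷
  (((# 2 , # 5) ∷ (# 3 , # 6) ∷ []) , ((# 0 , # 1) ∷ (# 2 , # 5) ∷ (# 3 , # 6) ∷ [])) ∷
  (((# 0 , # 1) ∷ (# 3 , # 6) ∷ []) , ((# 0 , # 1) ∷ (# 3 , # 6) ∷ (# 4 , # 5) ∷ [])) ∷
  (((# 0 , # 3) ∷ (# 1 , # 2) ∷ []) , ((# 0 , # 3) ∷ (# 1 , # 2) ∷ (# 4 , # 5) ∷ [])) ∷
  (((# 0 , # 3) ∷ (# 2 , # 6) ∷ []) , ((# 0 , # 3) ∷ (# 2 , # 6) ∷ (# 4 , # 5) ∷ [])) ∷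
  (((# 0 , # 6) ∷ (# 1 , # 3) ∷ []) , ((# 0 , # 6) ∷ (# 1 , # 3) ∷ (# 4 , # 5) ∷ [])) ∷
  (((# 0 , # 2) ∷ (# 3 , # 6) ∷ []) , ((# 0 , # 2) ∷ (# 3 , # 6) ∷ (# 4 , # 5) ∷ [])) ∷
  (((# 3 , # 6) ∷ (# 4 , # 5) ∷ []) , ((# 1 , # 2) ∷ (# 3 , # 6) ∷ (# 4 , # 5) ∷ [])) ∷
  (((# 1 , # 2) ∷ (# 4 , # 5) ∷ []) , ((# 0 , # 6) ∷ (# 1 , # 2) ∷ (# 4 , # 5) ∷ [])) ∷
  (((# 0 , # 2) ∷ (# 1 , # 3) ∷ []) , ((# 0 , # 2) ∷ (# 1 , # 3) ∷ (# 4 , # 5) ∷ [])) ∷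
  (((# 1 , # 3) ∷ (# 4 , # 5) ∷ []) , ((# 1 , # 3) ∷ (# 2 , # 6) ∷ (# 4 , # 5) ∷ [])) ∷
  (((# 2 , # 6) ∷ (# 4 , # 5) ∷ []) , ((# 0 , # 1) ∷ (# 2 , # 6) ∷ (# 4 , # 5) ∷ [])) ∷
  (((# 0 , # 4) ∷ (# 3 , # 5) ∷ []) , ((# 0 , # 4) ∷ (# 1 , # 6) ∷ (# 3 , # 5) ∷ [])) ∷
  (((# 0 , # 3) ∷ (# 2 , # 5) ∷ []) , ((# 0 , # 3) ∷ (# 1 , # 6) ∷ (# 2 , # 5) ∷ [])) ∷
  (((# 0 , # 2) ∷ (# 4 , # 5) ∷ []) , ((# 0 , # 2) ∷ (# 1 , # 6) ∷ (# 4 , # 5) ∷ [])) ∷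
  (((# 0 , # 4) ∷ (# 2 , # 5) ∷ []) , ((# 0 , # 4) ∷ (# 1 , # 6) ∷ (# 2 , # 5) ∷ [])) ∷
  (((# 2 , # 4) ∷ (# 3 , # 5) ∷ []) , ((# 1 , # 6) ∷ (# 2 , # 4) ∷ (# 3 , # 5) ∷ [])) ∷
  (((# 0 , # 3) ∷ (# 2 , # 4) ∷ []) , ((# 0 , # 3) ∷ (# 1 , # 6) ∷ (# 2 , # 4) ∷ [])) ∷
  (((# 0 , # 3) ∷ (# 4 , # 5) ∷ []) , ((# 0 , # 3) ∷ (# 1 , # 6) ∷ (# 4 , # 5) ∷ [])) ∷
  (((# 0 , # 2) ∷ (# 3 , # 5) ∷ []) , ((# 0 , # 2) ∷ (# 1 , # 6) ∷ (# 3 , # 5) ∷ [])) ∷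
  (((# 0 , # 3) ∷ []) , ((# 0 , # 3) ∷ (# 1 , # 6) ∷ [])) ∷
  (((# 3 , # 5) ∷ []) , ((# 1 , # 6) ∷ (# 3 , # 5) ∷ [])) ∷
  (((# 1 , # 6) ∷ (# 4 , # 5) ∷ []) , ((# 1 , # 6) ∷ (# 2 , # 3) ∷ (# 4 , # 5) ∷ [])) ∷
  (((# 1 , # 4) ∷ (# 5 , # 6) ∷ []) , ((# 1 , # 4) ∷ (# 2 , # 3) ∷ (# 5 , # 6) ∷ [])) ∷
  (((# 0 , # 1) ∷ (# 4 , # 6) ∷ []) , ((# 0 , # 1) ∷ (# 2 , # 3) ∷ (# 4 , # 6) ∷ [])) ∷
  (((# 0 , # 4) ∷ (# 5 , # 6) ∷ []) , ((# 0 , # 4) ∷ (# 2 , # 3) ∷ (# 5 , # 6) ∷ [])) ∷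
  (((# 2 , # 3) ∷ (# 5 , # 6) ∷ []) , ((# 0 , # 1) ∷ (# 2 , # 3) ∷ (# 5 , # 6) ∷ [])) ∷
  (((# 0 , # 1) ∷ (# 4 , # 5) ∷ []) , ((# 0 , # 1) ∷ (# 2 , # 3) ∷ (# 4 , # 5) ∷ [])) ∷
  (((# 0 , # 6) ∷ (# 4 , # 5) ∷ []) , ((# 0 , # 6) ∷ (# 2 , # 3) ∷ (# 4 , # 5) ∷ [])) ∷
  (((# 1 , # 5) ∷ (# 4 , # 6) ∷ []) , ((# 1 , # 5) ∷ (# 2 , # 3) ∷ (# 4 , # 6) ∷ [])) ∷
  (((# 0 , # 4) ∷ (# 1 , # 6) ∷ []) , ((# 0 , # 4) ∷ (# 1 , # 6) ∷ (# 2 , # 3) ∷ [])) ∷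
  (((# 0 , # 4) ∷ (# 1 , # 5) ∷ []) , ((# 0 , # 4) ∷ (# 1 , # 5) ∷ (# 2 , # 3) ∷ [])) ∷
  (((# 0 , # 6) ∷ (# 1 , # 4) ∷ []) , ((# 0 , # 6) ∷ (# 1 , # 4) ∷ (# 2 , # 3) ∷ [])) ∷
  (((# 0 , # 6) ∷ (# 2 , # 3) ∷ []) , ((# 0 , # 6) ∷ (# 1 , # 5) ∷ (# 2 , # 3) ∷ [])) ∷
  (((# 0 , # 4) ∷ []) , ((# 0 , # 4) ∷ (# 2 , # 3) ∷ [])) ∷
  (((# 4 , # 5) ∷ []) , ((# 2 , # 3) ∷ (# 4 , # 5) ∷ [])) ∷
  (((# 1 , # 2) ∷ (# 5 , # 6) ∷ []) , ((# 1 , # 2) ∷ (# 3 , # 4) ∷ (# 5 , # 6) ∷ [])) ∷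
  (((# 1 , # 6) ∷ (# 2 , # 5) ∷ []) , ((# 1 , # 6) ∷ (# 2 , # 5) ∷ (# 3 , # 4) ∷ [])) ∷
  (((# 0 , # 1) ∷ (# 5 , # 6) ∷ []) , ((# 0 , # 1) ∷ (# 3 , # 4) ∷ (# 5 , # 6) ∷ [])) ∷
  (((# 0 , # 6) ∷ (# 1 , # 2) ∷ []) , ((# 0 , # 6) ∷ (# 1 , # 2) ∷ (# 3 , # 4) ∷ [])) ∷
  (((# 1 , # 5) ∷ (# 2 , # 6) ∷ []) , ((# 1 , # 5) ∷ (# 2 , # 6) ∷ (# 3 , # 4) ∷ [])) ∷
  (((# 0 , # 6) ∷ (# 2 , # 5) ∷ []) , ((# 0 , # 6) ∷ (# 2 , # 5) ∷ (# 3 , # 4) ∷ [])) ∷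
  (((# 0 , # 1) ∷ (# 2 , # 5) ∷ []) , ((# 0 , # 1) ∷ (# 2 , # 5) ∷ (# 3 , # 4) ∷ [])) ∷
  (((# 0 , # 6) ∷ (# 1 , # 5) ∷ []) , ((# 0 , # 6) ∷ (# 1 , # 5) ∷ (# 3 , # 4) ∷ [])) ∷
  (((# 0 , # 2) ∷ (# 1 , # 6) ∷ []) , ((# 0 , # 2) ∷ (# 1 , # 6) ∷ (# 3 , # 4) ∷ [])) ∷
  (((# 0 , # 2) ∷ (# 1 , # 5) ∷ []) , ((# 0 , # 2) ∷ (# 1 , # 5) ∷ (# 3 , # 4) ∷ [])) ∷
  (((# 0 , # 2) ∷ (# 5 , # 6) ∷ []) , ((# 0 , # 2) ∷ (# 3 , # 4) ∷ (# 5 , # 6) ∷ [])) ∷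
  (((# 0 , # 1) ∷ (# 2 , # 6) ∷ []) , ((# 0 , # 1) ∷ (# 2 , # 6) ∷ (# 3 , # 4) ∷ [])) ∷
  (((# 1 , # 5) ∷ []) , ((# 1 , # 5) ∷ (# 3 , # 4) ∷ [])) ∷
  (((# 2 , # 5) ∷ []) , ((# 2 , # 5) ∷ (# 3 , # 4) ∷ [])) ∷
  (((# 0 , # 1) ∷ []) , ((# 0 , # 1) ∷ (# 3 , # 4) ∷ [])) ∷
  (((# 0 , # 6) ∷ []) , ((# 0 , # 6) ∷ (# 3 , # 4) ∷ [])) ∷
  (((# 5 , # 6) ∷ []) , ((# 3 , # 4) ∷ (# 5 , # 6) ∷ [])) ∷
  (((# 0 , # 2) ∷ []) , ((# 0 , # 2) ∷ (# 3 , # 4) ∷ [])) ∷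
  (((# 1 , # 6) ∷ (# 2 , # 4) ∷ []) , ((# 0 , # 5) ∷ (# 1 , # 6) ∷ (# 2 , # 4) ∷ [])) ∷
  (((# 1 , # 2) ∷ (# 3 , # 4) ∷ []) , ((# 0 , # 5) ∷ (# 1 , # 2) ∷ (# 3 , # 4) ∷ [])) ∷
  (((# 1 , # 6) ∷ (# 2 , # 3) ∷ []) , ((# 0 , # 5) ∷ (# 1 , # 6) ∷ (# 2 , # 3) ∷ [])) ∷
  (((# 1 , # 2) ∷ (# 3 , # 6) ∷ []) , ((# 0 , # 5) ∷ (# 1 , # 2) ∷ (# 3 , # 6) ∷ [])) ∷
  (((# 1 , # 3) ∷ (# 2 , # 6) ∷ []) , ((# 0 , # 5) ∷ (# 1 , # 3) ∷ (# 2 , # 6) ∷ [])) ∷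
  (((# 2 , # 3) ∷ (# 4 , # 6) ∷ []) , ((# 0 , # 5) ∷ (# 2 , # 3) ∷ (# 4 , # 6) ∷ [])) ∷
  (((# 1 , # 3) ∷ (# 4 , # 6) ∷ []) , ((# 0 , # 5) ∷ (# 1 , # 3) ∷ (# 4 , # 6) ∷ [])) ∷
  (((# 1 , # 6) ∷ (# 3 , # 4) ∷ []) , ((# 0 , # 5) ∷ (# 1 , # 6) ∷ (# 3 , # 4) ∷ [])) ∷
  (((# 1 , # 3) ∷ (# 2 , # 4) ∷ []) , ((# 0 , # 5) ∷ (# 1 , # 3) ∷ (# 2 , # 4) ∷ [])) ∷
  (((# 2 , # 6) ∷ (# 3 , # 4) ∷ []) , ((# 0 , # 5) ∷ (# 2 , # 6) ∷ (# 3 , # 4) ∷ [])) ∷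
  (((# 1 , # 2) ∷ (# 4 , # 6) ∷ []) , ((# 0 , # 5) ∷ (# 1 , # 2) ∷ (# 4 , # 6) ∷ [])) ∷
  (((# 1 , # 4) ∷ (# 2 , # 3) ∷ []) , ((# 0 , # 5) ∷ (# 1 , # 4) ∷ (# 2 , # 3) ∷ [])) ∷
  (((# 1 , # 4) ∷ (# 2 , # 6) ∷ []) , ((# 0 , # 5) ∷ (# 1 , # 4) ∷ (# 2 , # 6) ∷ [])) ∷
  (((# 1 , # 4) ∷ (# 3 , # 6) ∷ []) , ((# 0 , # 5) ∷ (# 1 , # 4) ∷ (# 3 , # 6) ∷ [])) ∷
  (((# 2 , # 4) ∷ (# 3 , # 6) ∷ []) , ((# 0 , # 5) ∷ (# 2 , # 4) ∷ (# 3 , # 6) ∷ [])) ∷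
  (((# 2 , # 3) ∷ []) , ((# 0 , # 5) ∷ (# 2 , # 3) ∷ [])) ∷
  (((# 1 , # 6) ∷ []) , ((# 0 , # 5) ∷ (# 1 , # 6) ∷ [])) ∷
  (((# 1 , # 2) ∷ []) , ((# 0 , # 5) ∷ (# 1 , # 2) ∷ [])) ∷
  (((# 2 , # 4) ∷ []) , ((# 0 , # 5) ∷ (# 2 , # 4) ∷ [])) ∷
  (((# 1 , # 4) ∷ []) , ((# 0 , # 5) ∷ (# 1 , # 4) ∷ [])) ∷
  (((# 2 , # 6) ∷ []) , ((# 0 , # 5) ∷ (# 2 , # 6) ∷ [])) ∷
  (((# 1 , # 3) ∷ []) , ((# 0 , # 5) ∷ (# 1 , # 3) ∷ [])) ∷
  (((# 4 , # 6) ∷ []) , ((# 0 , # 5) ∷ (# 4 , # 6) ∷ [])) ∷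
  (((# 3 , # 6) ∷ []) , ((# 0 , # 5) ∷ (# 3 , # 6) ∷ [])) ∷
  (((# 3 , # 4) ∷ []) , ((# 0 , # 5) ∷ (# 3 , # 4) ∷ [])) ∷
  ([] , ((# 0 , # 5) ∷ [])) ∷
  []

critical₂ : List (Face 7)
critical₂ =
  ((# 0 , # 1) ∷ (# 2 , # 4) ∷ (# 3 , # 5) ∷ []) ∷
  ((# 0 , # 1) ∷ (# 2 , # 4) ∷ (# 5 , # 6) ∷ []) ∷
  ((# 0 , # 2) ∷ (# 1 , # 3) ∷ (# 4 , # 6) ∷ []) ∷
  ((# 0 , # 2) ∷ (# 1 , # 3) ∷ (# 5 , # 6) ∷ []) ∷
  ((# 0 , # 2) ∷ (# 1 , # 4) ∷ (# 3 , # 5) ∷ []) ∷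
  ((# 0 , # 2) ∷ (# 1 , # 4) ∷ (# 5 , # 6) ∷ []) ∷
  ((# 0 , # 2) ∷ (# 1 , # 5) ∷ (# 3 , # 6) ∷ []) ∷
  ((# 0 , # 2) ∷ (# 3 , # 5) ∷ (# 4 , # 6) ∷ []) ∷
  ((# 0 , # 3) ∷ (# 1 , # 2) ∷ (# 4 , # 6) ∷ []) ∷
  ((# 0 , # 3) ∷ (# 1 , # 4) ∷ (# 2 , # 6) ∷ []) ∷
  ((# 0 , # 3) ∷ (# 1 , # 4) ∷ (# 5 , # 6) ∷ []) ∷
  ((# 0 , # 3) ∷ (# 1 , # 5) ∷ (# 4 , # 6) ∷ []) ∷
  ((# 0 , # 4) ∷ (# 1 , # 2) ∷ (# 3 , # 5) ∷ []) ∷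
  ((# 0 , # 4) ∷ (# 1 , # 2) ∷ (# 5 , # 6) ∷ []) ∷
  ((# 0 , # 4) ∷ (# 1 , # 3) ∷ (# 2 , # 6) ∷ []) ∷
  ((# 0 , # 6) ∷ (# 1 , # 3) ∷ (# 2 , # 4) ∷ []) ∷
  ((# 0 , # 6) ∷ (# 1 , # 4) ∷ (# 3 , # 5) ∷ []) ∷
  ((# 1 , # 2) ∷ (# 3 , # 5) ∷ (# 4 , # 6) ∷ []) ∷
  ((# 1 , # 3) ∷ (# 2 , # 4) ∷ (# 5 , # 6) ∷ []) ∷
  ((# 1 , # 3) ∷ (# 2 , # 5) ∷ (# 4 , # 6) ∷ []) ∷
  ((# 1 , # 4) ∷ (# 2 , # 5) ∷ (# 3 , # 6) ∷ []) ∷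
  ((# 1 , # 5) ∷ (# 2 , # 4) ∷ (# 3 , # 6) ∷ []) ∷
  []

critical₁ : List (Face 7)
critical₁ =
  ((# 0 , # 1) ∷ (# 2 , # 3) ∷ []) ∷
  ((# 1 , # 5) ∷ (# 2 , # 3) ∷ []) ∷
  []

critical₀ : List (Face 7)
critical₀ = ((# 0 , # 5) ∷ []) ∷ []

theorem1p4 : ∃[ V ] (IsGradientVectorField {7} V
    × ExactlyCritical V 2 22
    × ExactlyCritical V 1 2
    × ExactlyCritical V 0 1)
theorem1p4 =
  V₇ , forwardOrdered⇒gradient V₇ (from-yes (isDiscreteVectorField? V₇))
                                  (from-yes (forwardOrdered? V₇))
     , enumeratesCritical⇒exactlyCritical V₇ 2 critical₂ (from-yes (enumeratesCritical? V₇ 2 critical₂))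
     , enumeratesCritical⇒exactlyCritical V₇ 1 critical₁ (from-yes (enumeratesCritical? V₇ 1 critical₁))
     , enumeratesCritical⇒exactlyCritical V₇ 0 critical₀ (from-yes (enumeratesCritical? V₇ 0 critical₀))
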